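{- Let $P$ be a path graph with vertices $v_1,\ldots,v_n$ embedded in a metric space (edge $e(v_i,v_{i+1})$ of length $|v_iv_{i+1}|$). Let $(i^*,j^*)$ with $1\le i^*<j^*\le n$ be an optimal pair, i.e., the radius $r^*$ of $G(i^*,j^*)$ is minimum among all $G(i,j)$, $1\le i<j\le n$. Let $v_{c^*}$ be a center of $G(i^*,j^*)$ and $v_{a^*}$ a farthest vertex of $v_{c^*}$ in $G(i^*,j^*)$, where $i^*<c^*<a^*<j^*$. Then $(c^*,j^*)$ is an optimal pair (the radius of $G(c^*,j^*)$ equals $r^*$) and $v_{c^*}$ is a center of $G(c^*,j^*)$.
   Context: The metric satisfies $|v_iv_j|=0$ iff $i=j$, symmetry, nonnegativity, and the triangle inequality. For $1\le i\le j\le n$, $G(i,j)=P\cup\{e(v_i,v_j)\}$ is $P$ with an added edge $e(v_i,v_j)$ of length $|v_iv_j|$ (equal to $P$ if $j\in\{i,i+1\}$). Distances in a graph are shortest path lengths. A farthest vertex of $v$ in $G$ is a vertex maximizing the distance from $v$. A center of a graph is a vertex minimizing the maximum distance to all vertices (centers are restricted to vertices), and that minimum value is the radius. -}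

module Defs where

open import Level using (0ℓ)
open import Data.Nat using (ℕ; suc)
open import Data.Fin using (Fin; toℕ)
open import Data.Product using (_×_; ∃; Σ)
open import Data.Sum using (_⊎_)
open import Relation.Binary.PropositionalEquality using (_≡_)
open import Relation.Binary.Structures using (IsTotalOrder)

-- The paper uses real numbers; Agda's stdlib has no
-- reals, so lengths live in an arbitrary totally ordered commutative
-- monoid with order-compatible (and order-cancellative) addition.
-- The real numbers (ℝ, ≤, +, 0) are an instance.

record LengthDomain : Set₁ where
  field
    D        : Set
    _≤_      : D → D → Set
    0#       : D
    _+_      : D → D → D
    isTotalOrder : IsTotalOrder _≡_ _≤_
    +-assoc  : ∀ a b c → (a + b) + c ≡ a + (b + c)
    +-comm   : ∀ a b → a + b ≡ b + a
    +-identityˡ : ∀ a → 0# + a ≡ a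
    +-mono-≤ : ∀ {a b c e} → a ≤ b → c ≤ e → (a + c) ≤ (b + e)
    +-cancelʳ-≤ : ∀ {a b c} → (a + c) ≤ (b + c) → a ≤ b

module _ (L : LengthDomain) where
  open LengthDomain L

  -- Metric on the vertices v_1..v_n (only the pairwise distances
  -- |v_i v_j| matter); vertex v_k is represented by k : Fin n.

  record IsMetric {n : ℕ} (δ : Fin n → Fin n → D) : Set where
    field
      zero⇒eq  : ∀ i j → δ i j ≡ 0# → i ≡ j
      eq⇒zero  : ∀ i → δ i i ≡ 0#
      sym      : ∀ i j → δ i j ≡ δ j i
      nonneg   : ∀ i j → 0# ≤ δ i j
      triangle : ∀ i j k → δ i k ≤ (δ i j + δ j k)

  EdgeRel : ℕ → Set₁
  EdgeRel n = Fin n → Fin n → D → Set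

  G : {n : ℕ} → (Fin n → Fin n → D) → Fin n → Fin n → EdgeRel n
  G δ i j u v w =
      (toℕ v ≡ suc (toℕ u) × w ≡ δ u v)
    ⊎ (toℕ u ≡ suc (toℕ v) × w ≡ δ u v)
    ⊎ (u ≡ i × v ≡ j × w ≡ δ u v)
    ⊎ (u ≡ j × v ≡ i × w ≡ δ u v)

  data Walk {n : ℕ} (E : EdgeRel n) : Fin n → Fin n → D → Set where
    here : ∀ {u} → Walk E u u 0#
    step : ∀ {u v t w l} → E u v w → Walk E v t l → Walk E u t (w + l)

  IsDist : {n : ℕ} → EdgeRel n → Fin n → Fin n → D → Set
  IsDist E u v r = Walk E u v r × (∀ l → Walk E u v l → r ≤ l)

  IsEcc : {n : ℕ} → EdgeRel n → Fin n → D → Set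
  IsEcc E u e = (∀ v r → IsDist E u v r → r ≤ e) × ∃ λ v → IsDist E u v e

  IsFarthest : {n : ℕ} → EdgeRel n → Fin n → Fin n → Set
  IsFarthest E u a =
    ∃ λ ra → IsDist E u a ra × (∀ v r → IsDist E u v r → r ≤ ra)

  IsCenter : {n : ℕ} → EdgeRel n → Fin n → Set
  IsCenter E c = ∃ λ e → IsEcc E c e × (∀ c' e' → IsEcc E c' e' → e ≤ e')

  IsRadius : {n : ℕ} → EdgeRel n → D → Set
  IsRadius E r = (∃ λ c → IsEcc E c r) × (∀ c e → IsEcc E c e → r ≤ e)

  IsOptimalPair : {n : ℕ} → (Fin n → Fin n → D) → Fin n → Fin n → Set
  IsOptimalPair δ i j =
    toℕ i Data.Nat.< toℕ j ×
    ∃ λ r → IsRadius (G δ i j) r ×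
      (∀ i' j' r' → toℕ i' Data.Nat.< toℕ j' → IsRadius (G δ i' j') r' → r ≤ r')

{-# OPTIONS --safe #-}
-- Distances in G(x,y) have a closed form: a shortest u–v path either stays on P or uses the
-- added edge once, in one of its two directions; the closed form is a lower bound on walk
-- lengths because it changes by at most the edge length along every edge (a potential).
-- In G(i*,j*) no shortest path from c* can use the edge from j* back to i*: it would run
-- along P through a* up to j* first, and so be longer than the distance to the farthest
-- vertex a* (as a* ≠ j*). Replacing the edge (i*,j*) by (c*,j*) only shortens the paths
-- that go forward over it, so the eccentricity of c* in G(c*,j*) is at most r*, while
-- optimality of (i*,j*) bounds the radius of G(c*,j*) from below by r*.
module Submission where

open import Defs
open import Level using (0ℓ)
open import Data.Nat using (ℕ; zero; suc; z≤n; s≤s; _<_) renaming (_≤_ to _≤ℕ_)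
open import Data.Nat.Properties using (<-trans; <-irrefl; <⇒≤; suc-injective)
open import Data.Fin using (Fin; toℕ; zero; suc)
open import Data.List.Base using (allFin)
open import Data.List.Relation.Unary.All using (lookup)
open import Data.List.Membership.Propositional.Properties using (∈-allFin)
open import Data.Product using (_×_; _,_; proj₁; proj₂)
open import Data.Sum using (_⊎_; inj₁; inj₂; [_,_]′)
open import Data.Empty using (⊥-elim)
open import Function using (id)
open import Relation.Binary.Bundles using (TotalOrder)
open import Relation.Binary.PropositionalEquality
  using (_≡_; refl; sym; trans; cong; subst; subst₂)
open import Relation.Binary.Structures using (IsTotalOrder)

module Lengths (L : LengthDomain) where
  open LengthDomain L renaming (_+_ to infixl 6 _+_; _≤_ to infix 4 _≤_)
  open IsTotalOrder isTotalOrder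
    using (antisym)
    renaming (refl to ≤-refl; trans to ≤-trans; reflexive to ≤-reflexive)

  totalOrder : TotalOrder 0ℓ 0ℓ 0ℓ
  totalOrder = record { isTotalOrder = isTotalOrder }

  open TotalOrder totalOrder using (poset)
  open import Algebra.Construct.NaturalChoice.Min totalOrder
    using (_⊓_; x⊓y≤x; x⊓y≤y; ⊓-sel; ⊓-glb; ⊓-comm; ⊓-assoc; mono-≤-distrib-⊓)
  open import Data.List.Extrema totalOrder using (argmax; argmin; f[xs]≤f[argmax]; f[argmin]≤f[xs])
  open import Relation.Binary.Reasoning.PartialOrder poset

  +-identityʳ : ∀ a → a + 0# ≡ a
  +-identityʳ a = trans (+-comm a 0#) (+-identityˡ a)

  +-monoˡ-≤ : ∀ c {a b} → a ≤ b → a + c ≤ b + c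
  +-monoˡ-≤ c a≤b = +-mono-≤ a≤b ≤-refl

  +-monoʳ-≤ : ∀ c {a b} → a ≤ b → c + a ≤ c + b
  +-monoʳ-≤ c a≤b = +-mono-≤ ≤-refl a≤b

  x≤x+y : ∀ x {y} → 0# ≤ y → x ≤ x + y
  x≤x+y x {y} 0≤y = begin
    x       ≡⟨ +-identityʳ x ⟨
    x + 0#  ≤⟨ +-monoʳ-≤ x 0≤y ⟩
    x + y   ∎

  x≤y+x : ∀ x {y} → 0# ≤ y → x ≤ y + x
  x≤y+x x {y} 0≤y = subst (x ≤_) (+-comm x y) (x≤x+y x 0≤y)

  +-nonneg : ∀ {x y} → 0# ≤ x → 0# ≤ y → 0# ≤ x + y
  +-nonneg {x} 0≤x 0≤y = ≤-trans 0≤x (x≤x+y x 0≤y)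

  x+y≤x⇒y≤0 : ∀ x {y} → x + y ≤ x → y ≤ 0#
  x+y≤x⇒y≤0 x {y} x+y≤x = +-cancelʳ-≤ (begin
    y + x   ≡⟨ +-comm y x ⟩
    x + y   ≤⟨ x+y≤x ⟩
    x       ≡⟨ +-identityˡ x ⟨
    0# + x  ∎)

  ⊓-rec : ∀ (P : D → Set) {a b} → P a → P b → P (a ⊓ b)
  ⊓-rec P {a} {b} pa pb =
    [ (λ eq → subst P (sym eq) pa) , (λ eq → subst P (sym eq) pb) ]′ (⊓-sel a b)

  +-distribʳ-⊓ : ∀ w a b → (a ⊓ b) + w ≡ (a + w) ⊓ (b + w)
  +-distribʳ-⊓ w = mono-≤-distrib-⊓ (cong (_+ w)) (+-monoˡ-≤ w)

  ≤-⊓-+ : ∀ {z a b w} → z ≤ a + w → z ≤ b + w → z ≤ (a ⊓ b) + w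
  ≤-⊓-+ {w = w} z≤a+w z≤b+w =
    ≤-trans (⊓-glb z≤a+w z≤b+w) (≤-reflexive (sym (+-distribʳ-⊓ w _ _)))

  record IsPotential {n} (E : EdgeRel L n) (f : Fin n → D) : Set where
    field bound : ∀ {a b w} → E a b w → f b ≤ f a + w
  open IsPotential

  module _ {n : ℕ} {E : EdgeRel L n} where

    _++ʷ_ : ∀ {a b c l₁ l₂} → Walk L E a b l₁ → Walk L E b c l₂ → Walk L E a c (l₁ + l₂)
    here ++ʷ w′ = subst (Walk L E _ _) (sym (+-identityˡ _)) w′
    step e w ++ʷ w′ = subst (Walk L E _ _) (sym (+-assoc _ _ _)) (step e (w ++ʷ w′))

    reverseʷ : (∀ {u v w} → E u v w → E v u w) → ∀ {a b l} → Walk L E a b l → Walk L E b a l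
    reverseʷ flip here = here
    reverseʷ flip (step {w = w} {l = l} e walk) =
      subst (Walk L E _ _) (trans (cong (l +_) (+-identityʳ w)) (+-comm l w))
        (reverseʷ flip walk ++ʷ step (flip e) here)

    potential-bound : ∀ {f} → IsPotential E f → ∀ {s t l} → Walk L E s t l → f t ≤ f s + l
    potential-bound {f} pot {s} here = ≤-reflexive (sym (+-identityʳ (f s)))
    potential-bound {f} pot {s} {t} (step {v = v} {w = w} {l = l} e walk) = begin
      f t            ≤⟨ potential-bound pot walk ⟩
      f v + l        ≤⟨ +-monoˡ-≤ l (pot .bound e) ⟩
      f s + w + l    ≡⟨ +-assoc (f s) w l ⟩
      f s + (w + l)  ∎

    ⊓-potential : ∀ {f g} → IsPotential E f → IsPotential E g → IsPotential E (λ v → f v ⊓ g v)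
    ⊓-potential {f} {g} pf pg .bound {b = b} e =
      ≤-⊓-+ (≤-trans (x⊓y≤x (f b) (g b)) (pf .bound e))
            (≤-trans (x⊓y≤y (f b) (g b)) (pg .bound e))

    +-potential : ∀ k {f} → IsPotential E f → IsPotential E (λ v → k + f v)
    +-potential k {f} pf .bound {a} {b} {w} e = begin
      k + f b        ≤⟨ +-monoʳ-≤ k (pf .bound e) ⟩
      k + (f a + w)  ≡⟨ +-assoc k (f a) w ⟨
      k + f a + w    ∎

  mapʷ : ∀ {n n′} {E : EdgeRel L n} {E′ : EdgeRel L n′} (f : Fin n → Fin n′)
       → (∀ {u v w} → E u v w → E′ (f u) (f v) w)
       → ∀ {a b l} → Walk L E a b l → Walk L E′ (f a) (f b) l
  mapʷ f g here = here
  mapʷ f g (step e walk) = step (g e) (mapʷ f g walk)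

  Weights : ℕ → Set
  Weights n = Fin n → Fin n → D

  shift : ∀ {n} → Weights (suc n) → Weights n
  shift δ x y = δ (suc x) (suc y)

  pathLen : ∀ {n} → Weights n → Fin n → Fin n → D
  pathLen δ zero zero = 0#
  pathLen {suc (suc n)} δ zero (suc z) = δ zero (suc zero) + pathLen (shift δ) zero z
  pathLen {suc (suc n)} δ (suc x) zero = δ zero (suc zero) + pathLen (shift δ) zero x
  pathLen {suc (suc n)} δ (suc x) (suc z) = pathLen (shift δ) x z

  PathEdge : ∀ {n} → Weights n → EdgeRel L n
  PathEdge δ u v w = (toℕ v ≡ suc (toℕ u) × w ≡ δ u v) ⊎ (toℕ u ≡ suc (toℕ v) × w ≡ δ u v)

  pathLen-refl : ∀ {n} (δ : Weights n) x → pathLen δ x x ≡ 0#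
  pathLen-refl δ zero = refl
  pathLen-refl {suc (suc n)} δ (suc x) = pathLen-refl (shift δ) x

  pathLen-sym : ∀ {n} (δ : Weights n) x z → pathLen δ x z ≡ pathLen δ z x
  pathLen-sym δ zero zero = refl
  pathLen-sym {suc (suc n)} δ zero (suc z) = refl
  pathLen-sym {suc (suc n)} δ (suc x) zero = refl
  pathLen-sym {suc (suc n)} δ (suc x) (suc z) = pathLen-sym (shift δ) x z

  pathLen-nonneg : ∀ {n} (δ : Weights n) → (∀ x y → 0# ≤ δ x y) → ∀ x z → 0# ≤ pathLen δ x z
  pathLen-nonneg δ δ-nonneg zero zero = ≤-refl
  pathLen-nonneg {suc (suc n)} δ δ-nonneg zero (suc z) =
    +-nonneg (δ-nonneg _ _) (pathLen-nonneg (shift δ) (λ x y → δ-nonneg _ _) zero z)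
  pathLen-nonneg {suc (suc n)} δ δ-nonneg (suc x) zero =
    +-nonneg (δ-nonneg _ _) (pathLen-nonneg (shift δ) (λ x y → δ-nonneg _ _) zero x)
  pathLen-nonneg {suc (suc n)} δ δ-nonneg (suc x) (suc z) =
    pathLen-nonneg (shift δ) (λ x y → δ-nonneg _ _) x z

  pathLen-adjacent : ∀ {n} (δ : Weights n) {a b} → toℕ b ≡ suc (toℕ a) → pathLen δ a b ≡ δ a b
  pathLen-adjacent {suc (suc n)} δ {zero} {suc zero} refl = +-identityʳ _
  pathLen-adjacent {suc (suc n)} δ {suc a} {suc b} eq = pathLen-adjacent (shift δ) (suc-injective eq)

  pathLen-additive : ∀ {n} (δ : Weights n) c a j → toℕ c ≤ℕ toℕ a → toℕ a ≤ℕ toℕ j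
                   → pathLen δ c a + pathLen δ a j ≡ pathLen δ c j
  pathLen-additive δ zero zero j _ _ = +-identityˡ _
  pathLen-additive {suc (suc n)} δ zero (suc a) (suc j) _ (s≤s a≤j) =
    trans (+-assoc _ _ _) (cong (δ zero (suc zero) +_) (pathLen-additive (shift δ) zero a j z≤n a≤j))
  pathLen-additive {suc (suc n)} δ (suc c) (suc a) (suc j) (s≤s c≤a) (s≤s a≤j) =
    pathLen-additive (shift δ) c a j c≤a a≤j

  pathLen-triangle : ∀ {n} (δ : Weights n) → (∀ x y → 0# ≤ δ x y)
                   → ∀ x y z → pathLen δ x z ≤ pathLen δ x y + pathLen δ y z
  pathLen-triangle δ δ-nonneg zero zero z = ≤-reflexive (sym (+-identityˡ _))
  pathLen-triangle {suc (suc n)} δ δ-nonneg zero (suc y) zero =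
    +-nonneg (pathLen-nonneg δ δ-nonneg zero (suc y)) (pathLen-nonneg δ δ-nonneg (suc y) zero)
  pathLen-triangle {suc (suc n)} δ δ-nonneg zero (suc y) (suc z) = begin
    δ₀₁ + p zero z              ≤⟨ +-monoʳ-≤ δ₀₁ (triangle′ zero y z) ⟩
    δ₀₁ + (p zero y + p y z)    ≡⟨ +-assoc _ _ _ ⟨
    δ₀₁ + p zero y + p y z      ∎
    where
    δ₀₁ : D
    δ₀₁ = δ zero (suc zero)
    p : Weights (suc n)
    p = pathLen (shift δ)
    triangle′ : ∀ x y z → p x z ≤ p x y + p y z
    triangle′ = pathLen-triangle (shift δ) (λ x y → δ-nonneg _ _)
  pathLen-triangle {suc (suc n)} δ δ-nonneg (suc x) zero zero = ≤-reflexive (sym (+-identityʳ _))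
  pathLen-triangle {suc (suc n)} δ δ-nonneg (suc x) zero (suc z) = begin
    p x z                              ≤⟨ triangle′ x zero z ⟩
    p x zero + p zero z                ≡⟨ cong (_+ p zero z) (pathLen-sym (shift δ) x zero) ⟩
    p zero x + p zero z                ≤⟨ +-mono-≤ (x≤y+x _ (δ-nonneg _ _)) (x≤y+x _ (δ-nonneg _ _)) ⟩
    δ₀₁ + p zero x + (δ₀₁ + p zero z)  ∎
    where
    δ₀₁ : D
    δ₀₁ = δ zero (suc zero)
    p : Weights (suc n)
    p = pathLen (shift δ)
    triangle′ : ∀ x y z → p x z ≤ p x y + p y z
    triangle′ = pathLen-triangle (shift δ) (λ x y → δ-nonneg _ _)
  pathLen-triangle {suc (suc n)} δ δ-nonneg (suc x) (suc y) zero = begin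
    δ₀₁ + p zero x              ≤⟨ +-monoʳ-≤ δ₀₁ (triangle′ zero y x) ⟩
    δ₀₁ + (p zero y + p y x)    ≡⟨ +-assoc _ _ _ ⟨
    δ₀₁ + p zero y + p y x      ≡⟨ +-comm _ _ ⟩
    p y x + (δ₀₁ + p zero y)    ≡⟨ cong (_+ (δ₀₁ + p zero y)) (pathLen-sym (shift δ) y x) ⟩
    p x y + (δ₀₁ + p zero y)    ∎
    where
    δ₀₁ : D
    δ₀₁ = δ zero (suc zero)
    p : Weights (suc n)
    p = pathLen (shift δ)
    triangle′ : ∀ x y z → p x z ≤ p x y + p y z
    triangle′ = pathLen-triangle (shift δ) (λ x y → δ-nonneg _ _)
  pathLen-triangle {suc (suc n)} δ δ-nonneg (suc x) (suc y) (suc z) =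
    pathLen-triangle (shift δ) (λ x y → δ-nonneg _ _) x y z

  pathEdge-weight : ∀ {n} {δ : Weights n} {u v w} → PathEdge δ u v w → w ≡ δ u v
  pathEdge-weight = [ proj₂ , proj₂ ]′

  pathEdge-flip : ∀ {n} {δ : Weights n} → (∀ x y → δ x y ≡ δ y x)
                → ∀ {u v w} → PathEdge δ u v w → PathEdge δ v u w
  pathEdge-flip δ-sym {u} {v} (inj₁ (adj , w≡)) = inj₂ (adj , trans w≡ (δ-sym u v))
  pathEdge-flip δ-sym {u} {v} (inj₂ (adj , w≡)) = inj₁ (adj , trans w≡ (δ-sym u v))

  pathEdge-shift : ∀ {n} {δ : Weights (suc n)} {u v w}
                 → PathEdge (shift δ) u v w → PathEdge δ (suc u) (suc v) w
  pathEdge-shift (inj₁ (adj , w≡)) = inj₁ (cong suc adj , w≡)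
  pathEdge-shift (inj₂ (adj , w≡)) = inj₂ (cong suc adj , w≡)

  pathWalk : ∀ {n} (δ : Weights n) → (∀ x y → δ x y ≡ δ y x)
           → ∀ x z → Walk L (PathEdge δ) x z (pathLen δ x z)
  pathWalk δ δ-sym zero zero = here
  pathWalk {suc (suc n)} δ δ-sym zero (suc z) =
    step (inj₁ (refl , refl))
      (mapʷ suc (pathEdge-shift {δ = δ}) (pathWalk (shift δ) (λ x y → δ-sym _ _) zero z))
  pathWalk {suc (suc n)} δ δ-sym (suc x) zero =
    reverseʷ (pathEdge-flip δ-sym) (step (inj₁ (refl , refl))
      (mapʷ suc (pathEdge-shift {δ = δ}) (pathWalk (shift δ) (λ x y → δ-sym _ _) zero x)))
  pathWalk {suc (suc n)} δ δ-sym (suc x) (suc z) =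
    mapʷ suc (pathEdge-shift {δ = δ}) (pathWalk (shift δ) (λ x y → δ-sym _ _) x z)

  pathLen-step : ∀ {n} (δ : Weights n) → (∀ x y → δ x y ≡ δ y x)
               → ∀ {a b w} → PathEdge δ a b w → pathLen δ a b ≡ w
  pathLen-step δ δ-sym (inj₁ (adj , refl)) = pathLen-adjacent δ adj
  pathLen-step δ δ-sym {a} {b} (inj₂ (adj , refl)) =
    trans (pathLen-sym δ a b) (trans (pathLen-adjacent δ adj) (δ-sym b a))

  pathLen-potential : ∀ {n} (δ : Weights n) → (∀ x y → 0# ≤ δ x y) → (∀ x y → δ x y ≡ δ y x)
                    → ∀ z → IsPotential (PathEdge δ) (pathLen δ z)
  pathLen-potential δ δ-nonneg δ-sym z .bound {a} {b} {w} e = begin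
    pathLen δ z b                  ≤⟨ pathLen-triangle δ δ-nonneg z a b ⟩
    pathLen δ z a + pathLen δ a b  ≡⟨ cong (pathLen δ z a +_) (pathLen-step δ δ-sym e) ⟩
    pathLen δ z a + w              ∎

  δ-≤-pathLen : ∀ {n} {δ : Weights n} → IsMetric L δ → ∀ x z → δ x z ≤ pathLen δ x z
  δ-≤-pathLen {δ = δ} metric x z = begin
    δ x z                  ≤⟨ potential-bound δ-potential (pathWalk δ δ-sym x z) ⟩
    δ x x + pathLen δ x z  ≡⟨ cong (_+ pathLen δ x z) (eq⇒zero x) ⟩
    0# + pathLen δ x z     ≡⟨ +-identityˡ _ ⟩
    pathLen δ x z          ∎
    where
    open IsMetric metric renaming (sym to δ-sym)
    δ-potential : IsPotential (PathEdge δ) (δ x)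
    δ-potential .bound {a} {b} e =
      ≤-trans (triangle x a b) (≤-reflexive (cong (δ x a +_) (sym (pathEdge-weight {δ = δ} e))))

  pathLen-prefix-≥⇒≡ : ∀ {n} {δ : Weights n} → IsMetric L δ → ∀ {c a j}
                     → toℕ c ≤ℕ toℕ a → toℕ a ≤ℕ toℕ j
                     → pathLen δ c j ≤ pathLen δ c a → a ≡ j
  pathLen-prefix-≥⇒≡ {δ = δ} metric {c} {a} {j} c≤a a≤j pcj≤pca =
    zero⇒eq a j (antisym (≤-trans (δ-≤-pathLen metric a j) paj≤0) (nonneg a j))
    where
    open IsMetric metric using (zero⇒eq; nonneg)
    paj≤0 : pathLen δ a j ≤ 0#
    paj≤0 = x+y≤x⇒y≤0 (pathLen δ c a)
      (subst (_≤ pathLen δ c a) (sym (pathLen-additive δ c a j c≤a a≤j)) pcj≤pca)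

  module ShortcutGraph {n} (δ : Weights n) (metric : IsMetric L δ) where
    open IsMetric metric renaming (sym to δ-sym; nonneg to δ-nonneg)

    via : Fin n → Fin n → Fin n → Fin n → D
    via x y u v = pathLen δ u x + δ x y + pathLen δ y v

    dist : Fin n → Fin n → Fin n → Fin n → D
    dist x y u v = pathLen δ u v ⊓ via x y u v ⊓ via y x u v

    dist≤pathLen : ∀ x y u v → dist x y u v ≤ pathLen δ u v
    dist≤pathLen x y u v = ≤-trans (x⊓y≤x _ _) (x⊓y≤x _ _)

    dist≤via : ∀ x y u v → dist x y u v ≤ via x y u v
    dist≤via x y u v = ≤-trans (x⊓y≤x _ _) (x⊓y≤y _ _)

    dist-swap : ∀ x y u v → dist y x u v ≡ dist x y u v
    dist-swap x y u v =
      trans (⊓-assoc _ _ _) (trans (cong (pathLen δ u v ⊓_) (⊓-comm _ _)) (sym (⊓-assoc _ _ _)))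

    pathEdge⇒G : ∀ {x y u v w} → PathEdge δ u v w → G L δ x y u v w
    pathEdge⇒G (inj₁ e) = inj₁ e
    pathEdge⇒G (inj₂ e) = inj₂ (inj₁ e)

    pathWalkG : ∀ x y u v → Walk L (G L δ x y) u v (pathLen δ u v)
    pathWalkG x y u v = mapʷ id pathEdge⇒G (pathWalk δ δ-sym u v)

    jumpEdge : ∀ x y → G L δ x y x y (δ x y)
    jumpEdge x y = inj₂ (inj₂ (inj₁ (refl , refl , refl)))

    jumpEdge-back : ∀ x y → G L δ x y y x (δ y x)
    jumpEdge-back x y = inj₂ (inj₂ (inj₂ (refl , refl , refl)))

    viaWalk : ∀ {x y s t} → G L δ x y s t (δ s t) → ∀ u v → Walk L (G L δ x y) u v (via s t u v)
    viaWalk {x} {y} {s} {t} jump u v =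
      subst (Walk L _ u v) (cong (λ l → pathLen δ u s + l + pathLen δ t v) (+-identityʳ (δ s t)))
        ((pathWalkG x y u s ++ʷ step jump here) ++ʷ pathWalkG x y t v)

    dist-walk : ∀ x y u v → Walk L (G L δ x y) u v (dist x y u v)
    dist-walk x y u v = ⊓-rec (Walk L (G L δ x y) u v)
      (⊓-rec (Walk L (G L δ x y) u v) (pathWalkG x y u v) (viaWalk (jumpEdge x y) u v))
      (viaWalk (jumpEdge-back x y) u v)

    dist-jump : ∀ x y u → dist x y u y ≤ dist x y u x + δ x y
    dist-jump x y u = ≤-⊓-+ (≤-⊓-+ dist≤jump (≤-trans dist≤jump jump≤via)) dist≤via-back
      where
      jump : D
      jump = pathLen δ u x + δ x y
      dist≤jump : dist x y u y ≤ jump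
      dist≤jump = begin
        dist x y u y          ≤⟨ dist≤via x y u y ⟩
        jump + pathLen δ y y  ≡⟨ cong (jump +_) (pathLen-refl δ y) ⟩
        jump + 0#             ≡⟨ +-identityʳ jump ⟩
        jump                  ∎
      jump≤via : jump ≤ via x y u x + δ x y
      jump≤via = ≤-trans (x≤x+y jump (pathLen-nonneg δ δ-nonneg y x)) (x≤x+y _ (δ-nonneg x y))
      dist≤via-back : dist x y u y ≤ via y x u x + δ x y
      dist≤via-back = begin
        dist x y u y           ≤⟨ dist≤pathLen x y u y ⟩
        pathLen δ u y          ≤⟨ x≤x+y _ (δ-nonneg y x) ⟩
        pathLen δ u y + δ y x  ≤⟨ x≤x+y _ (pathLen-nonneg δ δ-nonneg x x) ⟩
        via y x u x            ≤⟨ x≤x+y _ (δ-nonneg x y) ⟩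
        via y x u x + δ x y    ∎

    dist-pathPotential : ∀ x y u → IsPotential (PathEdge δ) (dist x y u)
    dist-pathPotential x y u =
      ⊓-potential (⊓-potential (along u) (+-potential _ (along y))) (+-potential _ (along x))
      where
      along : ∀ z → IsPotential (PathEdge δ) (pathLen δ z)
      along = pathLen-potential δ δ-nonneg δ-sym

    dist-potential : ∀ x y u → IsPotential (G L δ x y) (dist x y u)
    dist-potential x y u .bound (inj₁ e) = dist-pathPotential x y u .bound (inj₁ e)
    dist-potential x y u .bound (inj₂ (inj₁ e)) = dist-pathPotential x y u .bound (inj₂ e)
    dist-potential x y u .bound (inj₂ (inj₂ (inj₁ (refl , refl , refl)))) =
      dist-jump x y u
    dist-potential x y u .bound (inj₂ (inj₂ (inj₂ (refl , refl , refl)))) =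
      subst₂ (λ a b → a ≤ b + δ y x) (dist-swap x y u x) (dist-swap x y u y) (dist-jump y x u)

    dist-isDist : ∀ x y u v → IsDist L (G L δ x y) u v (dist x y u v)
    dist-isDist x y u v = dist-walk x y u v , λ l walk → begin
      dist x y u v       ≤⟨ potential-bound (dist-potential x y u) walk ⟩
      dist x y u u + l   ≤⟨ +-monoˡ-≤ l (dist≤pathLen x y u u) ⟩
      pathLen δ u u + l  ≡⟨ cong (_+ l) (pathLen-refl δ u) ⟩
      0# + l             ≡⟨ +-identityˡ l ⟩
      l                  ∎

    shortcut-within-farthest : ∀ {i c a j ra} → toℕ c ≤ℕ toℕ a → toℕ a < toℕ j
      → IsDist L (G L δ i j) c a ra → (∀ v r → IsDist L (G L δ i j) c v r → r ≤ ra)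
      → ∀ v → dist c j c v ≤ ra
    shortcut-within-farthest {i} {c} {a} {j} {ra} c≤a a<j a-dist a-farthest v =
      ⊓-rec Shortens (⊓-rec Shortens along-path via-forward) via-backward
        (a-farthest v _ (dist-isDist i j c v))
      where
      Shortens : D → Set
      Shortens z = z ≤ ra → dist c j c v ≤ ra
      along-path : Shortens (pathLen δ c v)
      along-path pcv≤ra = ≤-trans (dist≤pathLen c j c v) pcv≤ra
      via-forward : Shortens (via i j c v)
      via-forward via≤ra = begin
        dist c j c v                           ≤⟨ dist≤via c j c v ⟩
        pathLen δ c c + δ c j + pathLen δ j v  ≡⟨ cong (λ l → l + δ c j + pathLen δ j v) (pathLen-refl δ c) ⟩
        0# + δ c j + pathLen δ j v             ≡⟨ cong (_+ pathLen δ j v) (+-identityˡ _) ⟩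
        δ c j + pathLen δ j v                  ≤⟨ +-monoˡ-≤ _ (triangle c i j) ⟩
        δ c i + δ i j + pathLen δ j v          ≤⟨ +-monoˡ-≤ _ (+-monoˡ-≤ _ (δ-≤-pathLen metric c i)) ⟩
        pathLen δ c i + δ i j + pathLen δ j v  ≤⟨ via≤ra ⟩
        ra                                     ∎
      via-backward : Shortens (via j i c v)
      via-backward via≤ra = ⊥-elim (<-irrefl (cong toℕ a≡j) a<j)
        where
        a≡j : a ≡ j
        a≡j = pathLen-prefix-≥⇒≡ metric c≤a (<⇒≤ a<j) (begin
          pathLen δ c j                          ≤⟨ x≤x+y _ (δ-nonneg j i) ⟩
          pathLen δ c j + δ j i                  ≤⟨ x≤x+y _ (pathLen-nonneg δ δ-nonneg i v) ⟩
          pathLen δ c j + δ j i + pathLen δ i v  ≤⟨ via≤ra ⟩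
          ra                                     ≤⟨ proj₂ a-dist _ (pathWalkG i j c a) ⟩
          pathLen δ c a                          ∎)

  module FiniteGraph {n} (E : EdgeRel L n) (v₀ : Fin n)
    (d : Fin n → Fin n → D) (d-isDist : ∀ u v → IsDist L E u v (d u v)) where

    farthest : Fin n → Fin n
    farthest u = argmax (d u) v₀ (allFin n)

    ecc : Fin n → D
    ecc u = d u (farthest u)

    ecc-isEcc : ∀ u → IsEcc L E u (ecc u)
    ecc-isEcc u = within , (farthest u , d-isDist u (farthest u))
      where
      within : ∀ v r → IsDist L E u v r → r ≤ ecc u
      within v r r-isDist = ≤-trans (proj₂ r-isDist _ (proj₁ (d-isDist u v)))
        (lookup (f[xs]≤f[argmax] {f = d u} v₀ (allFin n)) (∈-allFin v))

    center : Fin n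
    center = argmin ecc v₀ (allFin n)

    ecc-center-isRadius : IsRadius L E (ecc center)
    ecc-center-isRadius = (center , ecc-isEcc center) , least
      where
      least : ∀ c e → IsEcc L E c e → ecc center ≤ e
      least c e e-isEcc = ≤-trans (lookup (f[argmin]≤f[xs] {f = ecc} v₀ (allFin n)) (∈-allFin c))
        (proj₁ e-isEcc (farthest c) (ecc c) (d-isDist c (farthest c)))

lemma5 : (L : LengthDomain) → (n : ℕ)
    → (δ : Fin n → Fin n → LengthDomain.D L) → IsMetric L δ
    → (i* j* c* a* : Fin n)
    → toℕ i* < toℕ c* → toℕ c* < toℕ a* → toℕ a* < toℕ j*
    → IsOptimalPair L δ i* j*
    → IsCenter L (G L δ i* j*) c*
    → IsFarthest L (G L δ i* j*) c* a*
    → (r* : LengthDomain.D L) → IsRadius L (G L δ i* j*) r*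
    → IsOptimalPair L δ c* j* × IsRadius L (G L δ c* j*) r* × IsCenter L (G L δ c* j*) c*
lemma5 L n δ metric i j c a _ c<a a<j
       (_ , r₀ , ((c₀ , c₀-ecc) , _) , r₀-optimal) (e , (e-bound , _) , e-least)
       (ra , a-dist , a-farthest) r* ((c* , c*-ecc) , r*-least) =
  (c<j , r* , r*-isRadius , r*-optimal) , r*-isRadius , (r* , c-ecc , r*-lower)
  where
  open LengthDomain L using (_≤_)
  open IsTotalOrder (LengthDomain.isTotalOrder L) using (antisym) renaming (trans to ≤-trans)
  open Lengths L using (module ShortcutGraph; module FiniteGraph)
  open ShortcutGraph δ metric using (dist; dist-isDist; shortcut-within-farthest)
  open FiniteGraph (G L δ c j) c (dist c j) (dist-isDist c j)
  c<j : toℕ c < toℕ j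
  c<j = <-trans c<a a<j
  r*-optimal : ∀ i′ j′ r′ → toℕ i′ < toℕ j′ → IsRadius L (G L δ i′ j′) r′ → r* ≤ r′
  r*-optimal i′ j′ r′ i′<j′ r′-isRadius =
    ≤-trans (r*-least c₀ r₀ c₀-ecc) (r₀-optimal i′ j′ r′ i′<j′ r′-isRadius)
  r*-lower : ∀ c′ e′ → IsEcc L (G L δ c j) c′ e′ → r* ≤ e′
  r*-lower c′ e′ e′-isEcc =
    ≤-trans (r*-optimal c j _ c<j ecc-center-isRadius) (proj₂ ecc-center-isRadius c′ e′ e′-isEcc)
  ecc-c≤r* : ecc c ≤ r*
  ecc-c≤r* = ≤-trans (shortcut-within-farthest (<⇒≤ c<a) a<j a-dist a-farthest (farthest c))
                     (≤-trans (e-bound a ra a-dist) (e-least c* r* c*-ecc))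
  c-ecc : IsEcc L (G L δ c j) c r*
  c-ecc = subst (IsEcc L (G L δ c j) c)
    (antisym ecc-c≤r* (r*-lower c (ecc c) (ecc-isEcc c))) (ecc-isEcc c)
  r*-isRadius : IsRadius L (G L δ c j) r*
  r*-isRadius = (c , c-ecc) , r*-lower
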